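{- Let $G=(V,E,\chi)$ be a vertex-coloured graph and $f$ a flip function for $G$. Then $\chi^{G}_{(\infty)}\equiv\chi^{G,f}_{(\infty)}$, where $\chi^{G}_{(\infty)}$ is the stable colouring computed by colour refinement on $G$ and $\chi^{G,f}_{(\infty)}$ is the stable colouring computed by colour refinement on the flipped graph $G^f$.
   Context: Colour refinement on a coloured graph $(G,\chi)$: $\chi_0=\chi$, $\chi_{i+1}(v)=(\chi_i(v),\{\!\{\chi_i(w)\mid w\in N(v)\}\!\})$; the stable colouring is $\chi_i$ for the least $i$ such that the partition of $V$ into colour classes of $\chi_{i+1}$ is not strictly finer than that of $\chi_i$. A flip function is a symmetric map $f:\mathcal C\times\mathcal C\to\{0,1\}$ on the colour set; $G^f=(V,E^f,\chi)$ with $E^f=\{vw\in E\mid f(\chi(v),\chi(w))=0\}\cup\{vw\mid v\ne w, vw\notin E, f(\chi(v),\chi(w))=1\}$. For colourings $\chi_1,\chi_2$ of $V$, $\chi_1\equiv\chi_2$ means they induce the same partition of $V$ into colour classes. -}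

module Defs where

open import Data.Nat using (ℕ; zero; suc; _<_)
open import Data.Fin using (Fin; _≟_)
open import Data.Bool using (Bool; true; false; if_then_else_; _xor_)
open import Data.Product using (Σ; _×_; proj₁; _,_)
open import Relation.Binary.PropositionalEquality using (_≡_)
open import Relation.Nullary using (¬_)
open import Relation.Nullary.Decidable using (⌊_⌋)
open import Data.Empty using (⊥-elim)
open import Function.Bundles using (_↔_; _⇔_; Inverse)

record ColGraph (n : ℕ) (C : Set) : Set where
  field
    adj    : Fin n → Fin n → Bool
    sym    : ∀ v w → adj v w ≡ adj w v
    irrefl : ∀ v → adj v v ≡ false
    col    : Fin n → C

open ColGraph public

-- A flip function: symmetric map C × C → {0,1} (false = 0, true = 1).
record FlipFunction (C : Set) : Set where
  field
    fl     : C → C → Bool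
    fl-sym : ∀ c d → fl c d ≡ fl d c

open FlipFunction public

-- The flipped graph G^f: for v ≠ w, vw ∈ E^f iff
--   (vw ∈ E and f(χv,χw) = 0) or (vw ∉ E and f(χv,χw) = 1),
-- i.e. adj v w xor f(χv,χw).  Colouring unchanged.
flipAdj : ∀ {n C} → ColGraph n C → FlipFunction C → Fin n → Fin n → Bool
flipAdj G f v w =
  if ⌊ v ≟ w ⌋ then false else (adj G v w xor fl f (col G v) (col G w))

N : ∀ {n C} → ColGraph n C → Fin n → Set
N {n} G v = Σ (Fin n) (λ u → adj G v u ≡ true)


-- SameCol G i v w  :  χ_i(v) = χ_i(w)  for colour refinement on G.
--   χ_0 = χ;
--   χ_{i+1}(v) = (χ_i(v), {{ χ_i(u) | u ∈ N(v) }}), and two such pairs are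
--   equal iff the first components agree and the multisets agree, i.e. there
--   is a bijection N(v) ↔ N(w) preserving χ_i.
SameCol : ∀ {n C} → ColGraph n C → ℕ → Fin n → Fin n → Set
SameCol G zero    v w = col G v ≡ col G w
SameCol G (suc i) v w =
  SameCol G i v w ×
  Σ (N G v ↔ N G w) (λ π → ∀ (u : N G v) →
      SameCol G i (proj₁ u) (proj₁ (Inverse.to π u)))

-- The partitions of χ_{i+1} and χ_i coincide (χ_{i+1} is always finer,
-- so "not strictly finer" is exactly this).
Stabilises : ∀ {n C} → ColGraph n C → ℕ → Set
Stabilises G i = ∀ v w → (SameCol G (suc i) v w ⇔ SameCol G i v w)

-- i is the least index at which refinement stabilises; χ_i is then the
-- stable colouring χ_(∞).
IsStableIndex : ∀ {n C} → ColGraph n C → ℕ → Set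
IsStableIndex G i = Stabilises G i × (∀ j → j < i → ¬ Stabilises G j)

flipGraph : ∀ {n C} → ColGraph n C → FlipFunction C → ColGraph n C
flipGraph {n} G f = record
  { adj = flipAdj G f ; sym = s ; irrefl = r ; col = col G }
  where
  open import Relation.Nullary using (yes; no)
  open import Relation.Binary.PropositionalEquality using (refl; sym; cong₂)
  s : ∀ v w → flipAdj G f v w ≡ flipAdj G f w v
  s v w with v ≟ w | w ≟ v
  ... | yes _ | yes _ = refl
  ... | yes refl | no ne = ⊥-elim (ne refl)
  ... | no ne | yes refl = ⊥-elim (ne refl)
  ... | no _ | no _ = cong₂ _xor_ (ColGraph.sym G v w) (fl-sym f (col G v) (col G w))
  r : ∀ v → flipAdj G f v v ≡ false
  r v with v ≟ v
  ... | yes _ = refl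
  ... | no ne = ⊥-elim (ne refl)

-- Write χ_k for the depth-k colouring of G. The key observation is a
-- characterisation of one refinement step: χ_{k+1}(v) = χ_{k+1}(w) iff some
-- χ_k-preserving permutation of the vertices sends v to w and the
-- neighbourhood of v onto the neighbourhood of w (an "alignment").
-- One direction extends the given χ_k-preserving bijection N(v) ↔ N(w) to
-- the whole vertex set, one transposition at a time; the other restricts
-- the permutation to the neighbourhoods.
-- An alignment only moves vertices inside χ_k-classes, hence inside
-- χ-classes, so it also aligns v and w in any graph whose adjacency between
-- distinct vertices is a function of the G-adjacency and the two colours;
-- G^f is such a graph for G and vice versa. By induction on k, G and G^f
-- therefore have the same depth-k partition for every k. Since a stabilised
-- refinement never changes again, the stable colourings of G (at i) and of
-- G^f (at j) both induce the partition at depth i + j, which gives the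
-- theorem (minimality of the stabilisation indices is not needed).
module Submission where

open import Defs hiding (sym)
open import Data.Nat using (ℕ; zero; suc; _+_)
open import Data.Nat.Properties using (+-comm)
open import Data.Fin using (Fin; _≟_)
open import Data.Fin.Permutation
  using (Permutation′; _⟨$⟩ʳ_; _⟨$⟩ˡ_; inverseˡ; inverseʳ; id; _∘ₚ_; transpose)
import Data.Fin.Permutation.Components as Components
open import Data.Bool using (Bool; true; false; _xor_)
open import Data.Bool.Properties using (xor-assoc; xor-same; xor-identityʳ)
  renaming (_≟_ to _≟-Bool_)
open import Data.List using (List; []; _∷_; allFin)
open import Data.List.Membership.Propositional using (_∈_)
open import Data.List.Membership.Propositional.Properties using (∈-allFin)
open import Data.List.Relation.Unary.Any using (here; there)
open import Data.Product using (Σ; _,_; proj₁; proj₂)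
open import Data.Empty using (⊥-elim)
open import Function.Bundles using (_⇔_; _↔_; Equivalence; Inverse; mk⇔; mk↔ₛ′)
open import Function.Construct.Composition using (_↔-∘_; _⇔-∘_)
open import Function.Construct.Identity using (↔-id; ⇔-id)
open import Function.Construct.Symmetry using (↔-sym)
open import Function.Properties.Equivalence using (⇔-setoid)
open import Level using (0ℓ)
open import Relation.Binary.Structures using (IsEquivalence)
open import Relation.Binary.PropositionalEquality
open import Relation.Nullary using (yes; no)
open import Axiom.UniquenessOfIdentityProofs using (module Decidable⇒UIP)
import Relation.Binary.Reasoning.Setoid as SetoidReasoning

Members : ∀ {n} → (Fin n → Bool) → Set
Members {n} A = Σ (Fin n) (λ x → A x ≡ true)

members-≡ : ∀ {n} {A : Fin n → Bool} {u u′ : Members A} → proj₁ u ≡ proj₁ u′ → u ≡ u′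
members-≡ {u = x , p} {.x , q} refl = cong (x ,_) (Decidable⇒UIP.≡-irrelevant _≟-Bool_ p q)

xor-cancelʳ : ∀ a b → (a xor b) xor b ≡ a
xor-cancelʳ a b = begin
  (a xor b) xor b   ≡⟨ xor-assoc a b b ⟩
  a xor (b xor b)   ≡⟨ cong (a xor_) (xor-same b) ⟩
  a xor false       ≡⟨ xor-identityʳ a ⟩
  a                 ∎
  where open ≡-Reasoning

module _ {n : ℕ} {C : Set} (G : ColGraph n C) where

  sameCol⇒sameColour : ∀ k {v w} → SameCol G k v w → col G v ≡ col G w
  sameCol⇒sameColour zero    e       = e
  sameCol⇒sameColour (suc k) (e , _) = sameCol⇒sameColour k e

  sameCol-isEquivalence : ∀ k → IsEquivalence (SameCol G k)
  sameCol-isEquivalence zero = record { refl = refl ; sym = sym ; trans = trans }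
  sameCol-isEquivalence (suc k) = record
    { refl  = R.refl , ↔-id _ , λ _ → R.refl
    ; sym   = λ (e , π , r) → R.sym e , ↔-sym π , backwards π r
    ; trans = λ (e , π , r) (e′ , π′ , r′) →
                R.trans e e′ , π′ ↔-∘ π , λ u → R.trans (r u) (r′ (Inverse.to π u))
    }
    where
    module R = IsEquivalence (sameCol-isEquivalence k)
    backwards : ∀ {v w} (π : N G v ↔ N G w) →
                (∀ u → SameCol G k (proj₁ u) (proj₁ (Inverse.to π u))) →
                ∀ u → SameCol G k (proj₁ u) (proj₁ (Inverse.from π u))
    backwards π r u =
      R.sym (subst (λ z → SameCol G k (proj₁ (Inverse.from π u)) (proj₁ z))
                   (Inverse.strictlyInverseˡ π u) (r (Inverse.from π u)))

  refine-mono : ∀ {k k′} → (∀ {a b} → SameCol G k a b → SameCol G k′ a b) →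
                ∀ {v w} → SameCol G (suc k) v w → SameCol G (suc k′) v w
  refine-mono h (e , π , r) = h e , π , λ u → h (r u)

  stable-forever : ∀ {i} → Stabilises G i → ∀ m v w → SameCol G (m + i) v w ⇔ SameCol G i v w
  stable-forever st zero    v w = ⇔-id _
  stable-forever {i} st (suc m) v w = st v w ⇔-∘ step
    where
    step : SameCol G (suc (m + i)) v w ⇔ SameCol G (suc i) v w
    step = mk⇔ (refine-mono λ {a b} → Equivalence.to (stable-forever st m a b))
               (refine-mono λ {a b} → Equivalence.from (stable-forever st m a b))

module _ {n : ℕ} where

  perm-injective : (P : Permutation′ n) → ∀ {x y} → P ⟨$⟩ʳ x ≡ P ⟨$⟩ʳ y → x ≡ y
  perm-injective P {x} {y} e = begin
    x                    ≡⟨ inverseˡ P ⟨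
    P ⟨$⟩ˡ (P ⟨$⟩ʳ x)   ≡⟨ cong (P ⟨$⟩ˡ_) e ⟩
    P ⟨$⟩ˡ (P ⟨$⟩ʳ y)   ≡⟨ inverseˡ P ⟩
    y                    ∎
    where open ≡-Reasoning

  restrict : ∀ {A B : Fin n → Bool} (P : Permutation′ n) → (∀ x → A x ≡ B (P ⟨$⟩ʳ x)) →
             Members A ↔ Members B
  restrict {B = B} P maps = mk↔ₛ′
    (λ (x , a) → P ⟨$⟩ʳ x , trans (sym (maps x)) a)
    (λ (y , b) → P ⟨$⟩ˡ y , trans (maps _) (trans (cong B (inverseʳ P)) b))
    (λ _ → members-≡ (inverseʳ P))
    (λ _ → members-≡ (inverseˡ P))

  data TransposeCase (i j k : Fin n) : Fin n → Set where
    at-i      : k ≡ i →          TransposeCase i j k j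
    at-j      : k ≢ i → k ≡ j → TransposeCase i j k i
    elsewhere : k ≢ i → k ≢ j → TransposeCase i j k k

  transpose-case : ∀ i j k → TransposeCase i j k (Components.transpose i j k)
  transpose-case i j k with k ≟ i
  ... | yes k≡i = at-i k≡i
  ... | no  k≢i with k ≟ j
  ...   | yes k≡j = at-j k≢i k≡j
  ...   | no  k≢j = elsewhere k≢i k≢j

  redirect : Permutation′ n → Fin n → Fin n → Permutation′ n
  redirect P a b = P ∘ₚ transpose (P ⟨$⟩ʳ a) b

  redirect-hits : ∀ P a b → redirect P a b ⟨$⟩ʳ a ≡ b
  redirect-hits P a b
    with Components.transpose (P ⟨$⟩ʳ a) b (P ⟨$⟩ʳ a) | transpose-case (P ⟨$⟩ʳ a) b (P ⟨$⟩ʳ a)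
  ... | _ | at-i _              = refl
  ... | _ | at-j Pa≢Pa _        = ⊥-elim (Pa≢Pa refl)
  ... | _ | elsewhere Pa≢Pa _   = ⊥-elim (Pa≢Pa refl)

  redirect-keeps : ∀ P a b x → x ≢ a → P ⟨$⟩ʳ x ≢ b → redirect P a b ⟨$⟩ʳ x ≡ P ⟨$⟩ʳ x
  redirect-keeps P a b x x≢a Px≢b
    with Components.transpose (P ⟨$⟩ʳ a) b (P ⟨$⟩ʳ x) | transpose-case (P ⟨$⟩ʳ a) b (P ⟨$⟩ʳ x)
  ... | _ | at-i Px≡Pa      = ⊥-elim (x≢a (perm-injective P Px≡Pa))
  ... | _ | at-j _ Px≡b     = ⊥-elim (Px≢b Px≡b)
  ... | _ | elsewhere _ _   = refl

  redirect-maps : ∀ {A B : Fin n → Bool} P a b → (∀ x → A x ≡ B (P ⟨$⟩ʳ x)) → A a ≡ B b →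
                  ∀ x → A x ≡ B (redirect P a b ⟨$⟩ʳ x)
  redirect-maps {A} {B} P a b maps ab x
    with Components.transpose (P ⟨$⟩ʳ a) b (P ⟨$⟩ʳ x) | transpose-case (P ⟨$⟩ʳ a) b (P ⟨$⟩ʳ x)
  ... | _ | at-i Px≡Pa      = subst (λ y → A y ≡ B b) (sym (perm-injective P Px≡Pa)) ab
  ... | _ | at-j _ Px≡b     = trans (maps x) (trans (cong B Px≡b) (trans (sym ab) (maps a)))
  ... | _ | elsewhere _ _   = maps x

module Preserving {n : ℕ} {R : Fin n → Fin n → Set} (isEquivalence : IsEquivalence R) where
  open IsEquivalence isEquivalence renaming (refl to R-refl; sym to R-sym; trans to R-trans)

  Preserves : Permutation′ n → Set
  Preserves P = ∀ x → R x (P ⟨$⟩ʳ x)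

  redirect-preserves : ∀ {P a b} → Preserves P → R a b → Preserves (redirect P a b)
  redirect-preserves {P} {a} {b} pres Rab x
    with Components.transpose (P ⟨$⟩ʳ a) b (P ⟨$⟩ʳ x) | transpose-case (P ⟨$⟩ʳ a) b (P ⟨$⟩ʳ x)
  ... | _ | at-i Px≡Pa    = subst (λ y → R y b) (sym (perm-injective P Px≡Pa)) Rab
  ... | _ | at-j _ Px≡b   = R-trans (subst (R x) Px≡b (pres x)) (R-trans (R-sym Rab) (pres a))
  ... | _ | elsewhere _ _ = pres x

  module Extend {A B : Fin n → Bool} (π : Members A ↔ Members B)
                (π-preserves : ∀ u → R (proj₁ u) (proj₁ (Inverse.to π u))) where

    image : Members A → Fin n
    image u = proj₁ (Inverse.to π u)

    image-injective : ∀ {u u′} → image u ≡ image u′ → proj₁ u ≡ proj₁ u′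
    image-injective {u} {u′} e = cong proj₁ (begin
      u                              ≡⟨ Inverse.strictlyInverseʳ π u ⟨
      Inverse.from π (Inverse.to π u)  ≡⟨ cong (Inverse.from π) (members-≡ e) ⟩
      Inverse.from π (Inverse.to π u′) ≡⟨ Inverse.strictlyInverseʳ π u′ ⟩
      u′                             ∎)
      where open ≡-Reasoning

    record AgreesOn (xs : List (Fin n)) : Set where
      field
        perm      : Permutation′ n
        preserves : Preserves perm
        agrees    : ∀ (u : Members A) → proj₁ u ∈ xs → perm ⟨$⟩ʳ proj₁ u ≡ image u

    agreeOn : ∀ xs → AgreesOn xs
    agreeOn [] = record { perm = id ; preserves = λ _ → R-refl ; agrees = λ _ () }
    agreeOn (a ∷ xs) with A a in Aa
    ... | false = record { perm = perm ; preserves = preserves ; agrees = agrees′ }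
      where
      open AgreesOn (agreeOn xs)
      agrees′ : ∀ (u : Members A) → proj₁ u ∈ a ∷ xs → perm ⟨$⟩ʳ proj₁ u ≡ image u
      agrees′ (x , Ax) (here refl) with () ← trans (sym Ax) Aa
      agrees′ u        (there x∈xs) = agrees u x∈xs
    ... | true = record
      { perm      = redirect perm a (image (a , Aa))
      ; preserves = redirect-preserves {perm} {a} preserves (π-preserves (a , Aa))
      ; agrees    = agrees′ }
      where
      open AgreesOn (agreeOn xs)
      hit : ∀ (u : Members A) → proj₁ u ≡ a →
            redirect perm a (image (a , Aa)) ⟨$⟩ʳ proj₁ u ≡ image u
      hit (x , _) refl = trans (redirect-hits perm a _) (cong image (members-≡ refl))
      agrees′ : ∀ (u : Members A) → proj₁ u ∈ a ∷ xs →
                redirect perm a (image (a , Aa)) ⟨$⟩ʳ proj₁ u ≡ image u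
      agrees′ u (here x≡a) = hit u x≡a
      agrees′ u (there x∈xs) with proj₁ u ≟ a
      ... | yes x≡a = hit u x≡a
      ... | no  x≢a = trans (redirect-keeps perm a _ (proj₁ u) x≢a
                               (λ e → x≢a (image-injective (trans (sym (agrees u x∈xs)) e))))
                            (agrees u x∈xs)

    record Extension : Set where
      field
        perm      : Permutation′ n
        preserves : Preserves perm
        maps      : ∀ x → A x ≡ B (perm ⟨$⟩ʳ x)

    -- Agreeing with π on all of Fin n forces A to be mapped onto B.
    extension : Extension
    extension = record { perm = perm ; preserves = preserves ; maps = maps }
      where
      open AgreesOn (agreeOn (allFin n))
      comes-from-A : ∀ x → B (perm ⟨$⟩ʳ x) ≡ true → A x ≡ true
      comes-from-A x BPx = subst (λ y → A y ≡ true) source-is-x (proj₂ source)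
        where
        source : Members A
        source = Inverse.from π (perm ⟨$⟩ʳ x , BPx)
        source-is-x : proj₁ source ≡ x
        source-is-x = perm-injective perm (begin
          perm ⟨$⟩ʳ proj₁ source  ≡⟨ agrees source (∈-allFin _) ⟩
          image source            ≡⟨ cong proj₁ (Inverse.strictlyInverseˡ π _) ⟩
          perm ⟨$⟩ʳ x             ∎)
          where open ≡-Reasoning
      maps : ∀ x → A x ≡ B (perm ⟨$⟩ʳ x)
      maps x with A x in Ax
      ... | true = sym (subst (λ y → B y ≡ true) (sym (agrees (x , Ax) (∈-allFin x)))
                              (proj₂ (Inverse.to π (x , Ax))))
      ... | false with B (perm ⟨$⟩ʳ x) in BPx
      ...   | false = refl
      ...   | true  with () ← trans (sym Ax) (comes-from-A x BPx)

module _ {n : ℕ} {C : Set} (G : ColGraph n C) where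

  record Alignment (k : ℕ) (v w : Fin n) : Set where
    field
      perm      : Permutation′ n
      preserves : ∀ x → SameCol G k x (perm ⟨$⟩ʳ x)
      centre    : perm ⟨$⟩ʳ v ≡ w
      adjacency : ∀ x → adj G v x ≡ adj G w (perm ⟨$⟩ʳ x)

    aligned-sameCol : SameCol G k v w
    aligned-sameCol = subst (SameCol G k v) centre (preserves v)

  -- χ_{k+1}(v) = χ_{k+1}(w) yields an alignment: extend the neighbourhood
  -- bijection to all vertices, then redirect v to w (both are non-adjacent to themselves).
  sameCol⇒alignment : ∀ k {v w} → SameCol G (suc k) v w → Alignment k v w
  sameCol⇒alignment k {v} {w} (e , π , π-preserves) = record
    { perm      = redirect perm v w
    ; preserves = redirect-preserves {perm} {v} preserves e
    ; centre    = redirect-hits perm v w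
    ; adjacency = redirect-maps {B = adj G w} perm v w maps (trans (irrefl G v) (sym (irrefl G w)))
    }
    where
    open Preserving (sameCol-isEquivalence G k)
    open Extend π π-preserves
    open Extension extension

  alignment⇒sameCol : ∀ {k v w} → Alignment k v w → SameCol G (suc k) v w
  alignment⇒sameCol a = aligned-sameCol , restrict perm adjacency , λ u → preserves (proj₁ u)
    where open Alignment a

module _ {n : ℕ} {C : Set} where

  record DeterminedBy (H G : ColGraph n C) : Set where
    field
      same-colour    : ∀ v → col H v ≡ col G v
      same-adjacency : ∀ {v x v′ x′} → v ≢ x → v′ ≢ x′ →
                       col G v ≡ col G v′ → col G x ≡ col G x′ →
                       adj G v x ≡ adj G v′ x′ → adj H v x ≡ adj H v′ x′

  xor-determined : ∀ {H G : ColGraph n C} (h : C → C → Bool) →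
                   (∀ v → col H v ≡ col G v) →
                   (∀ {v x} → v ≢ x → adj H v x ≡ adj G v x xor h (col G v) (col G x)) →
                   DeterminedBy H G
  xor-determined {H} {G} h same-colour changes = record
    { same-colour    = same-colour
    ; same-adjacency = λ v≢x v′≢x′ cv cx a → begin
        adj H _ _                              ≡⟨ changes v≢x ⟩
        adj G _ _ xor h (col G _) (col G _)    ≡⟨ cong₂ _xor_ a (cong₂ h cv cx) ⟩
        adj G _ _ xor h (col G _) (col G _)    ≡⟨ changes v′≢x′ ⟨
        adj H _ _                              ∎
    }
    where open ≡-Reasoning

  transport-alignment : ∀ {G H : ColGraph n C} {k v w} → DeterminedBy H G →
                        (∀ {a b} → SameCol G k a b → SameCol H k a b) →
                        Alignment G k v w → Alignment H k v w
  transport-alignment {G} {H} {k} {v} {w} D transfer a = record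
    { perm      = perm
    ; preserves = λ x → transfer (preserves x)
    ; centre    = centre
    ; adjacency = adjacency′
    }
    where
    open Alignment a
    open DeterminedBy D
    adjacency′ : ∀ x → adj H v x ≡ adj H w (perm ⟨$⟩ʳ x)
    adjacency′ x with x ≟ v
    ... | yes refl = trans (irrefl H x) (sym (trans (cong (adj H w) centre) (irrefl H w)))
    ... | no  x≢v  = same-adjacency (λ v≡x → x≢v (sym v≡x))
                       (λ w≡Px → x≢v (perm-injective perm (trans (sym w≡Px) (sym centre))))
                       (sameCol⇒sameColour G k aligned-sameCol)
                       (sameCol⇒sameColour G k (preserves x))
                       (adjacency x)

  transfer : ∀ {G H : ColGraph n C} → DeterminedBy H G → ∀ k {v w} → SameCol G k v w → SameCol H k v w
  transfer D zero {v} {w} e =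
    trans (same-colour v) (trans e (sym (same-colour w))) where open DeterminedBy D
  transfer {G} {H} D (suc k) s =
    alignment⇒sameCol H (transport-alignment D (transfer D k) (sameCol⇒alignment G k s))

module _ {n : ℕ} {C : Set} (G : ColGraph n C) (f : FlipFunction C) where

  flipAdj-distinct : ∀ {v x} → v ≢ x → flipAdj G f v x ≡ adj G v x xor fl f (col G v) (col G x)
  flipAdj-distinct {v} {x} v≢x with v ≟ x
  ... | yes v≡x = ⊥-elim (v≢x v≡x)
  ... | no  _   = refl

  unflipAdj-distinct : ∀ {v x} → v ≢ x →
                       adj G v x ≡ flipAdj G f v x xor fl f (col G v) (col G x)
  unflipAdj-distinct {v} {x} v≢x = sym (begin
    flipAdj G f v x xor φ              ≡⟨ cong (_xor φ) (flipAdj-distinct v≢x) ⟩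
    (adj G v x xor φ) xor φ            ≡⟨ xor-cancelʳ (adj G v x) φ ⟩
    adj G v x                          ∎)
    where
    φ = fl f (col G v) (col G x)
    open ≡-Reasoning

  flip-invariant : ∀ k v w → SameCol G k v w ⇔ SameCol (flipGraph G f) k v w
  flip-invariant k v w = mk⇔
    (transfer (xor-determined (fl f) (λ _ → refl) flipAdj-distinct) k)
    (transfer (xor-determined (fl f) (λ _ → refl) unflipAdj-distinct) k)

corollary3p9 : ∀ {n : ℕ} {C : Set} (G : ColGraph n C) (f : FlipFunction C)
                 (i j : ℕ) →
                 IsStableIndex G i →
                 IsStableIndex (flipGraph G f) j →
                 ∀ (v w : Fin n) → (SameCol G i v w ⇔ SameCol (flipGraph G f) j v w)
corollary3p9 G f i j (G-stable , _) (Gᶠ-stable , _) v w = begin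
  SameCol G i v w          ≈⟨ stable-forever G G-stable j v w ⟨
  SameCol G (j + i) v w    ≈⟨ flip-invariant G f (j + i) v w ⟩
  SameCol Gᶠ (j + i) v w   ≡⟨ cong (λ k → SameCol Gᶠ k v w) (+-comm j i) ⟩
  SameCol Gᶠ (i + j) v w   ≈⟨ stable-forever Gᶠ Gᶠ-stable i v w ⟩
  SameCol Gᶠ j v w         ∎
  where
  Gᶠ = flipGraph G f
  open SetoidReasoning (⇔-setoid 0ℓ)
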